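{- Let $G=(X\sqcup\{u\},Y,E)$ be a bipartite graph (left part $X\sqcup\{u\}$, right part $Y$, edge set $E\subseteq(X\sqcup\{u\})\times Y$) that is constructible by conditioning, and let $v\notin Y$ be a new vertex. Then $G'=(X\sqcup\{u\},\,Y\sqcup\{v\},\,E\cup\{(u,v)\})$ is constructible by conditioning.
   Context: A bipartite graph $(X,Y,E)$ with $E\subseteq X\times Y$ is viewed as a 2-partite hypergraph with vertex classes $X$ (first) and $Y$ (second) and hyperedge set $E$; every vertex lies in some edge. A homomorphism $(X,Y,E)\to(X',Y',E')$ is a pair of maps $X\to X'$, $Y\to Y'$ mapping edges to edges. For $X_0\subseteq X$, $Y_0\subseteq Y$, the section (induced) subgraph is $(X_0,Y_0,E\cap(X_0\times Y_0))$. Constructible by conditioning (recursively, up to renaming of vertices): (1) A single edge $(\{a\},\{b\},\{(a,b)\})$ is constructible. (2) Doubling: given a constructible graph whose vertex set is partitioned into "fixed" vertices and "old" vertices, add for every old vertex $q$ a fresh copy $q'$ on the same side, and for every edge $e$ not both of whose endpoints are fixed add the edge $e'$ obtained by replacing each old endpoint by its copy (old edges are kept). The result is constructible. (3) Collapse: if $H$ is constructible, $H_0$ is the induced subgraph of $H$ on some vertex subset (with each side taken within its side), and there is a homomorphism from $H$ to $H_0$ that is the identity on the vertices of $H_0$, then $H_0$ is constructible. -}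

module Defs where

open import Data.Bool using (Bool; true; false)
open import Data.Unit using (⊤; tt)
open import Data.Empty using (⊥)
open import Data.Product using (Σ; _×_; _,_; proj₁; proj₂)
open import Data.Sum using (_⊎_; inj₁; inj₂)
open import Relation.Binary.PropositionalEquality using (_≡_)
open import Function.Bundles using (_↔_; _⇔_; Inverse)

record Graph : Set₁ where
  constructor graph
  field
    X : Set
    Y : Set
    E : X → Y → Set
open Graph public

record Hom (G H : Graph) : Set where
  constructor hom
  field
    fX : X G → X H
    fY : Y G → Y H
    fE : ∀ {x y} → E G x y → E H (fX x) (fY y)
open Hom public

record Iso (G H : Graph) : Set where
  field
    isoX : X G ↔ X H
    isoY : Y G ↔ Y H
    isoE : ∀ x y → E G x y ⇔ E H (Inverse.to isoX x) (Inverse.to isoY y)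

Section : (H : Graph) → (X H → Set) → (Y H → Set) → Graph
Section H P Q = graph (Σ (X H) P) (Σ (Y H) Q) (λ a b → E H (proj₁ a) (proj₁ b))

SingleEdge : Graph
SingleEdge = graph ⊤ ⊤ (λ _ _ → ⊤)

-- Doubling.  oldX / oldY mark the "old" vertices (true = old,
-- false = fixed).  Each old vertex q gets a fresh copy q' (inj₂);
-- old edges are kept (inj₁/inj₁), and every edge e not both of whose
-- endpoints are fixed yields e' obtained by replacing each old endpoint
-- by its copy.
Double : (H : Graph) → (X H → Bool) → (Y H → Bool) → Graph
Double H oldX oldY = graph X' Y' E'
  where
  X' : Set
  X' = X H ⊎ Σ (X H) (λ x → oldX x ≡ true)
  Y' : Set
  Y' = Y H ⊎ Σ (Y H) (λ y → oldY y ≡ true)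
  E' : X' → Y' → Set
  E' (inj₁ x) (inj₁ y) = E H x y
  E' (inj₂ (x , _)) (inj₁ y) = E H x y × oldY y ≡ false
  E' (inj₁ x) (inj₂ (y , _)) = E H x y × oldX x ≡ false
  E' (inj₂ (x , _)) (inj₂ (y , _)) = E H x y

data Constructible : Graph → Set₁ where
  single   : Constructible SingleEdge
  doubling : ∀ {H} (oldX : X H → Bool) (oldY : Y H → Bool) →
             Constructible H → Constructible (Double H oldX oldY)
  collapse : ∀ {H} (P : X H → Set) (Q : Y H → Set) →
             Constructible H →
             (h : Hom H (Section H P Q)) →
             (∀ (a : Σ (X H) P) → proj₁ (fX h (proj₁ a)) ≡ proj₁ a) →
             (∀ (b : Σ (Y H) Q) → proj₁ (fY h (proj₁ b)) ≡ proj₁ b) →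
             Constructible (Section H P Q)
  rename   : ∀ {G H} → Constructible G → Iso G H → Constructible H

-- Given G = (X ⊔ {u}, Y, E) (u = inj₂ tt), the graph
-- G' = (X ⊔ {u}, Y ⊔ {v}, E ∪ {(u,v)}) (v = inj₂ tt).
AddPendant : (X₀ Y₀ : Set) → (X₀ ⊎ ⊤ → Y₀ → Set) → Graph
AddPendant X₀ Y₀ E₀ = graph (X₀ ⊎ ⊤) (Y₀ ⊎ ⊤) E'
  where
  E' : X₀ ⊎ ⊤ → Y₀ ⊎ ⊤ → Set
  E' x (inj₁ y) = E₀ x y
  E' (inj₁ x) (inj₂ _) = ⊥
  E' (inj₂ _) (inj₂ _) = ⊤

-- Every left vertex of a constructible graph lies in an edge, so u has a
-- neighbour y₀.  Double G, declaring X old, u fixed and all of Y old.  Then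
-- no new edge meets an original vertex other than u, and collapsing every
-- copy x' onto u and every copy y' onto y₀' is a retraction onto the section
-- X ⊔ {u}, Y ⊔ {y₀'}, since each new edge goes to (u, y₀'), which is the copy
-- of the edge (u, y₀).  That section is G with the pendant edge (u, y₀').
module Submission where

open import Defs
open import Data.Unit using (⊤; tt)
open import Data.Sum using (_⊎_; inj₁; inj₂)
open import Data.Empty using (⊥)
open import Data.Bool using (Bool; true; false)
open import Data.Product using (Σ; _,_; proj₁)
open import Function.Base using (id)
open import Function.Bundles using (_⇔_; Inverse; mk↔ₛ′; mk⇔; Equivalence)
open import Relation.Binary.PropositionalEquality using (_≡_; refl; sym; cong; subst)

open Iso

Constructible⇒leftTotal : ∀ {G} → Constructible G → ∀ x → Σ (Y G) (E G x)
Constructible⇒leftTotal single x = tt , tt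
Constructible⇒leftTotal (doubling _ _ c) (inj₁ x) with Constructible⇒leftTotal c x
... | y , e = inj₁ y , e
Constructible⇒leftTotal (doubling _ oldY c) (inj₂ (x , _)) with Constructible⇒leftTotal c x
... | y , e with oldY y in old
...   | true  = inj₂ (y , old) , e
...   | false = inj₁ y , e , old
Constructible⇒leftTotal (collapse {H} _ _ c h fixX _) (x , p) with Constructible⇒leftTotal c x
... | y , e = fY h y , subst (λ x′ → E H x′ (proj₁ (fY h y))) (fixX (x , p)) (fE h e)
Constructible⇒leftTotal (rename {H = H} c iso) x
  with Constructible⇒leftTotal c (Inverse.from (isoX iso) x)
... | y , e = Inverse.to (isoY iso) y ,
              subst (λ x′ → E H x′ (Inverse.to (isoY iso) y))
                    (Inverse.strictlyInverseˡ (isoX iso) x)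
                    (Equivalence.to (isoE iso _ y) e)

module PendantByCollapse
  (X₀ Y₀ : Set) (E₀ : X₀ ⊎ ⊤ → Y₀ → Set) (y₀ : Y₀) (u~y₀ : E₀ (inj₂ tt) y₀) where

  G : Graph
  G = graph (X₀ ⊎ ⊤) Y₀ E₀

  G′ : Graph
  G′ = AddPendant X₀ Y₀ E₀

  oldX : X₀ ⊎ ⊤ → Bool
  oldX (inj₁ _) = true
  oldX (inj₂ _) = false

  oldY : Y₀ → Bool
  oldY _ = true

  Doubled : Graph
  Doubled = Double G oldX oldY

  y₀′ : Σ Y₀ (λ y → oldY y ≡ true)
  y₀′ = y₀ , refl

  keepX : X Doubled → Set
  keepX (inj₁ _) = ⊤
  keepX (inj₂ _) = ⊥

  keepY : Y Doubled → Set
  keepY (inj₁ _) = ⊤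
  keepY (inj₂ y′) = y′ ≡ y₀′

  Collapsed : Graph
  Collapsed = Section Doubled keepX keepY

  retractX : X Doubled → X Collapsed
  retractX (inj₁ x) = inj₁ x , tt
  retractX (inj₂ _) = inj₁ (inj₂ tt) , tt

  retractY : Y Doubled → Y Collapsed
  retractY (inj₁ y) = inj₁ y , tt
  retractY (inj₂ _) = inj₂ y₀′ , refl

  retract-edge : ∀ {x y} → E Doubled x y → E Collapsed (retractX x) (retractY y)
  retract-edge {inj₁ _}          {inj₁ _} e      = e
  retract-edge {inj₂ _}          {inj₁ _} (_ , ())
  retract-edge {inj₁ (inj₁ _)}   {inj₂ _} (_ , ())
  retract-edge {inj₁ (inj₂ tt)}  {inj₂ _} _      = u~y₀ , refl
  retract-edge {inj₂ _}          {inj₂ _} _      = u~y₀ , refl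

  retract : Hom Doubled Collapsed
  retract = hom retractX retractY (λ {x} {y} → retract-edge {x} {y})

  retractX-fixes : ∀ (a : Σ (X Doubled) keepX) → proj₁ (retractX (proj₁ a)) ≡ proj₁ a
  retractX-fixes (inj₁ _ , _) = refl

  retractY-fixes : ∀ (b : Σ (Y Doubled) keepY) → proj₁ (retractY (proj₁ b)) ≡ proj₁ b
  retractY-fixes (inj₁ _ , _)    = refl
  retractY-fixes (inj₂ _ , kept) = cong inj₂ (sym kept)

  toX : X Collapsed → X G′
  toX (inj₁ x , _) = x

  fromX : X G′ → X Collapsed
  fromX x = inj₁ x , tt

  toY : Y Collapsed → Y G′
  toY (inj₁ y , _) = inj₁ y
  toY (inj₂ _ , _) = inj₂ tt

  fromY : Y G′ → Y Collapsed
  fromY (inj₁ y) = inj₁ y , tt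
  fromY (inj₂ _) = inj₂ y₀′ , refl

  toX∘fromX : ∀ x → toX (fromX x) ≡ x
  toX∘fromX _ = refl

  fromX∘toX : ∀ a → fromX (toX a) ≡ a
  fromX∘toX (inj₁ _ , tt) = refl

  toY∘fromY : ∀ y → toY (fromY y) ≡ y
  toY∘fromY (inj₁ _)  = refl
  toY∘fromY (inj₂ tt) = refl

  fromY∘toY : ∀ b → fromY (toY b) ≡ b
  fromY∘toY (inj₁ _ , tt)   = refl
  fromY∘toY (inj₂ _ , refl) = refl

  toE : ∀ a b → E Collapsed a b ⇔ E G′ (toX a) (toY b)
  toE (inj₁ _ , _)         (inj₁ _ , _)    = mk⇔ id id
  toE (inj₁ (inj₁ _) , _)  (inj₂ _ , refl) = mk⇔ (λ { (_ , ()) }) (λ ())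
  toE (inj₁ (inj₂ tt) , _) (inj₂ _ , refl) = mk⇔ (λ _ → tt) (λ _ → u~y₀ , refl)

  Collapsed≅G′ : Iso Collapsed G′
  Collapsed≅G′ = record
    { isoX = mk↔ₛ′ toX fromX toX∘fromX fromX∘toX
    ; isoY = mk↔ₛ′ toY fromY toY∘fromY fromY∘toY
    ; isoE = toE
    }

  constructible-G′ : Constructible G → Constructible G′
  constructible-G′ cG =
    rename (collapse keepX keepY (doubling oldX oldY cG) retract retractX-fixes retractY-fixes)
           Collapsed≅G′

lemma7p2 : (X₀ Y₀ : Set) (E₀ : X₀ ⊎ ⊤ → Y₀ → Set) →
           Constructible (graph (X₀ ⊎ ⊤) Y₀ E₀) →
           Constructible (AddPendant X₀ Y₀ E₀)
lemma7p2 X₀ Y₀ E₀ cG with Constructible⇒leftTotal cG (inj₂ tt)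
... | y₀ , u~y₀ = PendantByCollapse.constructible-G′ X₀ Y₀ E₀ y₀ u~y₀ cG
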